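{- Let $k\ge0$. Then $$\mathcal{P}_3^k=\mathcal{P}_1^k\ \sqcup\ \Big(\bigsqcup_{i\in[k+6]}\bigsqcup_{j\in I_i}\mathcal{P}_{i,j}^k\Big)\ \sqcup\ \Big(\bigsqcup_{i\in[k+4]}\bigsqcup_{j\in J_i}\mathcal{Q}_{i,j}^k\Big).$$
   Context: For a positive integer $n$, $[n]=\{1,\dots,n\}$; arithmetic on $[k+6]$ is mod $k+6$ with representatives in $[k+6]$. $KG_{3,k}$ has as vertices the $3$-element subsets of $[k+6]$, adjacent iff disjoint. A vertex $v$ is stable if there is no $t\in[k+6]$ with $\{t,t+1\}\subseteq v$ (mod $k+6$), unstable otherwise. $S_{3,k}$ has the same vertices as $KG_{3,k}$ and the edges of $KG_{3,k}$ with at least one stable endpoint. For a graph $G$, $\mathcal{N}(G)$ is the neighborhood complex (simplices: nonempty vertex sets with a common neighbor in $G$). For a set $\sigma$ of vertices, $C_\sigma=[k+6]\setminus\bigcup_{\alpha\in\sigma}\alpha$. Let $X_1^k=\mathcal{N}(S_{3,k})$, $X_3^k=\mathcal{N}(KG_{3,k})$, $X_2^k=X_1^k\sqcup\{\sigma\in X_3^k\setminus X_1^k : |C_\sigma|=4\}$, and let $\mathcal{P}_i^k$ be the face poset (set of simplices ordered by inclusion) of $X_i^k$. For $s\in[k+6]$: $I_s=[k+6]\setminus\{s-1,s,s+1\}$; $J_s=[k+5]\setminus[2]$ if $s=1$, $J_s=[k+6]\setminus[s+1]$ if $1<s<k+5$, $J_s=\emptyset$ otherwise. $\mathcal{P}_{i,j}^k=\{\sigma\in\mathcal{P}_3^k\setminus\mathcal{P}_2^k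 : C_\sigma=\{i,i+1,j\}\}$ for $i\in[k+6]$, $j\in I_i$; $\mathcal{Q}_{i,j}^k=\{\sigma\in\mathcal{P}_2^k\setminus\mathcal{P}_1^k : C_\sigma=\{i,i+1,j,j+1\}\}$ for $i\in[k+4]$, $j\in J_i$. -}

module Defs where

open import Data.Nat using (ℕ; zero; suc; _+_; _∸_; _≤_; _<_)
open import Data.Nat.DivMod using (_mod_)
open import Data.Fin using (Fin)
open import Data.Fin.Subset using (Subset; _∈_; _∉_; ∁; _∩_; _∪_; ⁅_⁆; ∣_∣; ⊤)
open import Data.List using (List; []; foldr)
open import Data.List.Relation.Unary.All using (All)
open import Data.Product using (Σ; ∃; ∃-syntax; _×_)
open import Data.Sum using (_⊎_)
open import Relation.Nullary using (¬_)
open import Relation.Binary.PropositionalEquality using (_≡_; _≢_)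

-- Ground set [k+6]; we write N k = 6 + k (= k + 6, but reduces to a successor).
N : ℕ → ℕ
N k = 6 + k

-- Elements of [N k] are named by natural numbers, read modulo N k with
-- representatives 1..N k:  el t is the element  t (mod N k).
-- Internally element t ∈ [N k] is the index t-1 of Fin (N k).
el : (k : ℕ) → ℕ → Fin (N k)
el k t = (t + (5 + k)) mod (N k)

InRange : ℕ → ℕ → Set
InRange n t = 1 ≤ t × t ≤ n

IsVertex : (k : ℕ) → Subset (N k) → Set
IsVertex k v = ∣ v ∣ ≡ 3

Stable : (k : ℕ) → Subset (N k) → Set
Stable k v = ¬ (∃[ t ] (InRange (N k) t × el k t ∈ v × el k (suc t) ∈ v))

Disjoint : {n : ℕ} → Subset n → Subset n → Set
Disjoint {n} a b = (x : Fin n) → x ∈ a → x ∈ b → Data.Empty.⊥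
  where import Data.Empty

AdjKG : (k : ℕ) → Subset (N k) → Subset (N k) → Set
AdjKG k a b = IsVertex k a × IsVertex k b × Disjoint a b

AdjS : (k : ℕ) → Subset (N k) → Subset (N k) → Set
AdjS k a b = AdjKG k a b × (Stable k a ⊎ Stable k b)

-- A finite set of vertices is given by a list (order/multiplicity irrelevant:
-- every predicate below depends only on list membership).
NonEmpty : {A : Set} → List A → Set
NonEmpty xs = xs ≢ []

Nbhd : (k : ℕ) → (Subset (N k) → Subset (N k) → Set) → List (Subset (N k)) → Set
Nbhd k Adj σ = All (IsVertex k) σ × NonEmpty σ
             × (∃[ τ ] (IsVertex k τ × All (λ α → Adj α τ) σ))

C : (k : ℕ) → List (Subset (N k)) → Subset (N k)
C k σ = ∁ (foldr _∪_ Data.Fin.Subset.⊥ σ)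

P1 : (k : ℕ) → List (Subset (N k)) → Set
P1 k σ = Nbhd k (AdjS k) σ

P3 : (k : ℕ) → List (Subset (N k)) → Set
P3 k σ = Nbhd k (AdjKG k) σ

P2 : (k : ℕ) → List (Subset (N k)) → Set
P2 k σ = P1 k σ ⊎ (P3 k σ × ¬ P1 k σ × ∣ C k σ ∣ ≡ 4)

InI : (k : ℕ) → ℕ → ℕ → Set
InI k s j = InRange (N k) j × el k j ≢ el k (s ∸ 1) × el k j ≢ el k s × el k j ≢ el k (suc s)

-- j ∈ J_s:  [k+5]\[2] if s = 1;  [k+6]\[s+1] if 1 < s < k+5;  ∅ otherwise
InJ : (k : ℕ) → ℕ → ℕ → Set
InJ k s j = (s ≡ 1 × 3 ≤ j × j ≤ 5 + k)
          ⊎ (1 < s × s < 5 + k × 2 + s ≤ j × j ≤ N k)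

Pij : (k : ℕ) → ℕ → ℕ → List (Subset (N k)) → Set
Pij k i j σ = P3 k σ × ¬ P2 k σ × C k σ ≡ (⁅ el k i ⁆ ∪ ⁅ el k (suc i) ⁆ ∪ ⁅ el k j ⁆)

Qij : (k : ℕ) → ℕ → ℕ → List (Subset (N k)) → Set
Qij k i j σ = P2 k σ × ¬ P1 k σ
            × C k σ ≡ (⁅ el k i ⁆ ∪ ⁅ el k (suc i) ⁆ ∪ ⁅ el k j ⁆ ∪ ⁅ el k (suc j) ⁆)

InPUnion : (k : ℕ) → List (Subset (N k)) → Set
InPUnion k σ = ∃[ i ] ∃[ j ] (InRange (N k) i × InI k i j × Pij k i j σ)

InQUnion : (k : ℕ) → List (Subset (N k)) → Set
InQUnion k σ = ∃[ i ] ∃[ j ] (InRange (4 + k) i × InJ k i j × Qij k i j σ)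

module Submission where

-- Write x⁺, x⁻ for the cyclic successor and predecessor in [k+6] and call x, y
-- adjacent when one is the successor of the other.  Since 3-sets are adjacent in
-- KG_{3,k} iff disjoint, σ ∈ P₃ iff C_σ contains a 3-set, and σ ∈ P₁ iff moreover
-- every member of σ is stable or C_σ contains a stable 3-set, i.e. an
-- independent triple (three pairwise non-adjacent points).  So for σ ∈ P₃ \ P₁ the
-- set C_σ has three points but no independent triple, and the structure theorem
-- for such sets on a cycle of length ≥ 6 shows C_σ = {a, a⁺, b} or
-- C_σ = {a, a⁺, b, b⁺} with b ∉ {a⁻, a, a⁺}.  The first shape (three points, so
-- outside P₂) is a P_{i,j}; the second (four points) is a Q_{i,j} once the pairs
-- are ordered so that i < j.  These parameters are determined by the set, which
-- gives the disjointness of the families; the disjointness of the three parts is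
-- immediate from the definitions.

open import Defs
open import Data.Nat using (ℕ; zero; suc; _+_; _*_; _∸_; _≤_; _<_; z≤n; s≤s; _%_; _/_; NonZero)
open import Data.Nat.Properties
  using ( +-suc; +-comm; +-assoc; +-identityʳ; +-cancelˡ-≡; m≤m+n; m≤n+m; n≤1+n
        ; ≤-refl; ≤-reflexive; ≤-trans; ≤-pred; <⇒≤; <⇒≱; <-irrefl; <-asym; <-cmp; ≤∧≢⇒< )
open import Data.Nat.DivMod using (%-distribˡ-+; m%n%n≡m%n; [m+n]%n≡m%n; m<n⇒m%n≡m; m≡m%n+[m/n]*n)
open import Data.Bool using (true; false)
open import Data.Vec using (_∷_; []; here; there)
open import Data.Fin using (Fin; zero; suc; toℕ)
open import Data.Fin.Properties using (toℕ-fromℕ<; toℕ<n; toℕ-injective; any?; _≟_)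
open import Data.Fin.Subset using (Subset; _∈_; _∉_; _⊆_; _∪_; ⁅_⁆; ∣_∣) renaming (⊥ to ∅)
open import Data.Fin.Subset.Properties
  using ( _∈?_; x∈p∪q⁻; x∈p∪q⁺; x∈⁅x⁆; x∈⁅y⁆⇒x≡y; ∣⁅x⁆∣≡1; ∣⊥∣≡0; ∉⊥; ⊆-antisym; p⊆q⇒∣p∣≤∣q∣
        ; x∉p⇒x∈∁p; x∈∁p⇒x∉p )
open import Data.List using (List; []; _∷_; foldr)
open import Data.List.Relation.Unary.All as All using (All; []; _∷_; all?)
open import Data.Product using (Σ; ∃-syntax; _×_; _,_; proj₁; proj₂)
open import Data.Sum using (_⊎_; inj₁; inj₂; [_,_]′; map₁)
open import Data.Empty using (⊥; ⊥-elim)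
open import Function using (_∘_)
open import Function.Bundles using (_⇔_; mk⇔)
open import Relation.Nullary using (¬_; Dec; yes; no)
open import Relation.Nullary.Decidable using (_×-dec_; _⊎-dec_; ¬?; decidable-stable)
open import Relation.Binary using (tri<; tri≈; tri>)
open import Relation.Binary.PropositionalEquality

∣p∪q∣≤∣p∣+∣q∣ : ∀ {n} (p q : Subset n) → ∣ p ∪ q ∣ ≤ ∣ p ∣ + ∣ q ∣
∣p∪q∣≤∣p∣+∣q∣ [] [] = z≤n
∣p∪q∣≤∣p∣+∣q∣ (false ∷ p) (false ∷ q) = ∣p∪q∣≤∣p∣+∣q∣ p q
∣p∪q∣≤∣p∣+∣q∣ (false ∷ p) (true ∷ q) = ≤-trans (s≤s (∣p∪q∣≤∣p∣+∣q∣ p q)) (≤-reflexive (sym (+-suc _ _)))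
∣p∪q∣≤∣p∣+∣q∣ (true ∷ p) (false ∷ q) = s≤s (∣p∪q∣≤∣p∣+∣q∣ p q)
∣p∪q∣≤∣p∣+∣q∣ (true ∷ p) (true ∷ q) =
  s≤s (≤-trans (∣p∪q∣≤∣p∣+∣q∣ p q) (≤-trans (m≤n+m _ 1) (≤-reflexive (sym (+-suc _ _)))))

∣p∪q∣≡∣p∣+∣q∣ : ∀ {n} (p q : Subset n) → (∀ x → x ∈ p → x ∈ q → ⊥) → ∣ p ∪ q ∣ ≡ ∣ p ∣ + ∣ q ∣
∣p∪q∣≡∣p∣+∣q∣ [] [] d = refl
∣p∪q∣≡∣p∣+∣q∣ (false ∷ p) (false ∷ q) d = ∣p∪q∣≡∣p∣+∣q∣ p q (λ x a b → d (suc x) (there a) (there b))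
∣p∪q∣≡∣p∣+∣q∣ (false ∷ p) (true ∷ q) d =
  trans (cong suc (∣p∪q∣≡∣p∣+∣q∣ p q (λ x a b → d (suc x) (there a) (there b)))) (sym (+-suc _ _))
∣p∪q∣≡∣p∣+∣q∣ (true ∷ p) (false ∷ q) d =
  cong suc (∣p∪q∣≡∣p∣+∣q∣ p q (λ x a b → d (suc x) (there a) (there b)))
∣p∪q∣≡∣p∣+∣q∣ (true ∷ p) (true ∷ q) d = ⊥-elim (d zero here here)

-- The explicit sets {a, b, c} and {a, b, c, d}, written exactly as in the
-- definitions of P_{i,j} and Q_{i,j}, and the corresponding membership predicates.
set₃ : ∀ {n} → Fin n → Fin n → Fin n → Subset n
set₃ a b c = ⁅ a ⁆ ∪ ⁅ b ⁆ ∪ ⁅ c ⁆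

set₄ : ∀ {n} → Fin n → Fin n → Fin n → Fin n → Subset n
set₄ a b c d = ⁅ a ⁆ ∪ ⁅ b ⁆ ∪ ⁅ c ⁆ ∪ ⁅ d ⁆

OneOf₃ : ∀ {n} → Fin n → Fin n → Fin n → Fin n → Set
OneOf₃ w a b c = w ≡ a ⊎ w ≡ b ⊎ w ≡ c

OneOf₄ : ∀ {n} → Fin n → Fin n → Fin n → Fin n → Fin n → Set
OneOf₄ w a b c d = w ≡ a ⊎ OneOf₃ w b c d

OneOf₄-swap : ∀ {n} {w a b c d : Fin n} → OneOf₄ w a b c d → OneOf₄ w c d a b
OneOf₄-swap (inj₁ e) = inj₂ (inj₂ (inj₁ e))
OneOf₄-swap (inj₂ (inj₁ e)) = inj₂ (inj₂ (inj₂ e))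
OneOf₄-swap (inj₂ (inj₂ (inj₁ e))) = inj₁ e
OneOf₄-swap (inj₂ (inj₂ (inj₂ e))) = inj₂ (inj₁ e)

∈⁅⁆∪ : ∀ {n} {w a : Fin n} {p : Subset n} → w ∈ ⁅ a ⁆ ∪ p → w ≡ a ⊎ w ∈ p
∈⁅⁆∪ {a = a} {p} m = map₁ (x∈⁅y⁆⇒x≡y a) (x∈p∪q⁻ ⁅ a ⁆ p m)

∈set₃⇒ : ∀ {n} {w a b c : Fin n} → w ∈ set₃ a b c → OneOf₃ w a b c
∈set₃⇒ {c = c} m with ∈⁅⁆∪ m
... | inj₁ e = inj₁ e
... | inj₂ m′ with ∈⁅⁆∪ m′
...   | inj₁ e = inj₂ (inj₁ e)
...   | inj₂ m″ = inj₂ (inj₂ (x∈⁅y⁆⇒x≡y c m″))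

∈set₄⇒ : ∀ {n} {w a b c d : Fin n} → w ∈ set₄ a b c d → OneOf₄ w a b c d
∈set₄⇒ m with ∈⁅⁆∪ m
... | inj₁ e = inj₁ e
... | inj₂ m′ = inj₂ (∈set₃⇒ m′)

∈set₃⇐ : ∀ {n} {w a b c : Fin n} → OneOf₃ w a b c → w ∈ set₃ a b c
∈set₃⇐ (inj₁ refl) = x∈p∪q⁺ (inj₁ (x∈⁅x⁆ _))
∈set₃⇐ (inj₂ (inj₁ refl)) = x∈p∪q⁺ (inj₂ (x∈p∪q⁺ (inj₁ (x∈⁅x⁆ _))))
∈set₃⇐ (inj₂ (inj₂ refl)) = x∈p∪q⁺ (inj₂ (x∈p∪q⁺ (inj₂ (x∈⁅x⁆ _))))

∈set₄⇐ : ∀ {n} {w a b c d : Fin n} → OneOf₄ w a b c d → w ∈ set₄ a b c d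
∈set₄⇐ (inj₁ refl) = x∈p∪q⁺ (inj₁ (x∈⁅x⁆ _))
∈set₄⇐ (inj₂ h) = x∈p∪q⁺ (inj₂ (∈set₃⇐ h))

by-exclusion₃ : ∀ {n} {p : Subset n} {a b c : Fin n} →
                (∀ {w} → w ∈ p → w ≢ a → w ≢ b → w ≢ c → ⊥) → ∀ w → w ∈ p → OneOf₃ w a b c
by-exclusion₃ {a = a} {b} {c} none w w∈p with w ≟ a | w ≟ b | w ≟ c
... | yes e | _ | _ = inj₁ e
... | no _ | yes e | _ = inj₂ (inj₁ e)
... | no _ | no _ | yes e = inj₂ (inj₂ e)
... | no w≢a | no w≢b | no w≢c = ⊥-elim (none w∈p w≢a w≢b w≢c)

by-exclusion₄ : ∀ {n} {p : Subset n} {a b c d : Fin n} →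
                (∀ {w} → w ∈ p → w ≢ a → w ≢ b → w ≢ c → w ≢ d → ⊥) → ∀ w → w ∈ p → OneOf₄ w a b c d
by-exclusion₄ {a = a} {b} {c} {d} none w w∈p with w ≟ a | w ≟ b | w ≟ c | w ≟ d
... | yes e | _ | _ | _ = inj₁ e
... | no _ | yes e | _ | _ = inj₂ (inj₁ e)
... | no _ | no _ | yes e | _ = inj₂ (inj₂ (inj₁ e))
... | no _ | no _ | no _ | yes e = inj₂ (inj₂ (inj₂ e))
... | no w≢a | no w≢b | no w≢c | no w≢d = ⊥-elim (none w∈p w≢a w≢b w≢c w≢d)

set₃⊆ : ∀ {n} {p : Subset n} {a b c : Fin n} → a ∈ p → b ∈ p → c ∈ p → set₃ a b c ⊆ p
set₃⊆ a∈ b∈ c∈ m with ∈set₃⇒ m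
... | inj₁ refl = a∈
... | inj₂ (inj₁ refl) = b∈
... | inj₂ (inj₂ refl) = c∈

set₄⊆ : ∀ {n} {p : Subset n} {a b c d : Fin n} → a ∈ p → b ∈ p → c ∈ p → d ∈ p → set₄ a b c d ⊆ p
set₄⊆ a∈ b∈ c∈ d∈ m with ∈⁅⁆∪ m
... | inj₁ refl = a∈
... | inj₂ m′ = set₃⊆ b∈ c∈ d∈ m′

set₃-exact : ∀ {n} {p : Subset n} {a b c : Fin n} → a ∈ p → b ∈ p → c ∈ p →
             (∀ w → w ∈ p → OneOf₃ w a b c) → p ≡ set₃ a b c
set₃-exact a∈ b∈ c∈ only = ⊆-antisym (λ {w} m → ∈set₃⇐ (only w m)) (set₃⊆ a∈ b∈ c∈)

set₄-exact : ∀ {n} {p : Subset n} {a b c d : Fin n} → a ∈ p → b ∈ p → c ∈ p → d ∈ p →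
             (∀ w → w ∈ p → OneOf₄ w a b c d) → p ≡ set₄ a b c d
set₄-exact a∈ b∈ c∈ d∈ only = ⊆-antisym (λ {w} m → ∈set₄⇐ (only w m)) (set₄⊆ a∈ b∈ c∈ d∈)

set₃-≡⇒ : ∀ {n} {w a b c a′ b′ c′ : Fin n} → set₃ a b c ≡ set₃ a′ b′ c′ →
          OneOf₃ w a′ b′ c′ → OneOf₃ w a b c
set₃-≡⇒ {w = w} same m = ∈set₃⇒ (subst (w ∈_) (sym same) (∈set₃⇐ m))

set₄-≡⇒ : ∀ {n} {w a b c d a′ b′ c′ d′ : Fin n} → set₄ a b c d ≡ set₄ a′ b′ c′ d′ →
          OneOf₄ w a′ b′ c′ d′ → OneOf₄ w a b c d
set₄-≡⇒ {w = w} same m = ∈set₄⇒ (subst (w ∈_) (sym same) (∈set₄⇐ m))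

set₄-swap : ∀ {n} (a b c d : Fin n) → set₄ a b c d ≡ set₄ c d a b
set₄-swap a b c d = ⊆-antisym swap swap
  where
  swap : ∀ {a b c d} → set₄ a b c d ⊆ set₄ c d a b
  swap m = ∈set₄⇐ (OneOf₄-swap (∈set₄⇒ m))

∣⁅a⁆∪p∣ : ∀ {n} {a : Fin n} (p : Subset n) → a ∉ p → ∣ ⁅ a ⁆ ∪ p ∣ ≡ suc ∣ p ∣
∣⁅a⁆∪p∣ {a = a} p a∉p = trans (∣p∪q∣≡∣p∣+∣q∣ ⁅ a ⁆ p disjoint) (cong (_+ ∣ p ∣) (∣⁅x⁆∣≡1 a))
  where
  disjoint : ∀ x → x ∈ ⁅ a ⁆ → x ∈ p → ⊥
  disjoint x x∈a x∈p with x∈⁅y⁆⇒x≡y a x∈a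
  ... | refl = a∉p x∈p

∣set₃∣ : ∀ {n} {a b c : Fin n} → a ≢ b → a ≢ c → b ≢ c → ∣ set₃ a b c ∣ ≡ 3
∣set₃∣ {a = a} {b} {c} a≢b a≢c b≢c = begin
  ∣ set₃ a b c ∣            ≡⟨ ∣⁅a⁆∪p∣ _ (λ m → [ a≢b , (λ m′ → a≢c (x∈⁅y⁆⇒x≡y c m′)) ]′ (∈⁅⁆∪ m)) ⟩
  suc ∣ ⁅ b ⁆ ∪ ⁅ c ⁆ ∣     ≡⟨ cong suc (∣⁅a⁆∪p∣ _ (λ m → b≢c (x∈⁅y⁆⇒x≡y c m))) ⟩
  suc (suc ∣ ⁅ c ⁆ ∣)       ≡⟨ cong (λ z → suc (suc z)) (∣⁅x⁆∣≡1 c) ⟩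
  3                         ∎
  where open ≡-Reasoning

∣set₄∣ : ∀ {n} {a b c d : Fin n} → a ≢ b → a ≢ c → a ≢ d → b ≢ c → b ≢ d → c ≢ d →
         ∣ set₄ a b c d ∣ ≡ 4
∣set₄∣ a≢b a≢c a≢d b≢c b≢d c≢d =
  trans (∣⁅a⁆∪p∣ _ (λ m → [ a≢b , [ a≢c , a≢d ]′ ]′ (∈set₃⇒ m))) (cong suc (∣set₃∣ b≢c b≢d c≢d))

outside-smaller : ∀ {n} (p q : Subset n) → ∣ q ∣ < ∣ p ∣ → ∃[ x ] (x ∈ p × x ∉ q)
outside-smaller p q q<p with any? (λ x → (x ∈? p) ×-dec ¬? (x ∈? q))
... | yes found = found
... | no none = ⊥-elim (<⇒≱ q<p (p⊆q⇒∣p∣≤∣q∣ p⊆q))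
  where
  p⊆q : p ⊆ q
  p⊆q {x} x∈p = decidable-stable (x ∈? q) (λ x∉q → none (x , x∈p , x∉q))

Distinct₃ : ∀ {n} → Subset n → Set
Distinct₃ {n} τ = Σ (Fin n) λ x → Σ (Fin n) λ y → Σ (Fin n) λ z →
                    x ∈ τ × y ∈ τ × z ∈ τ × x ≢ y × x ≢ z × y ≢ z

-- A 3-element set has three distinct members: pick points outside ∅, {x} and
-- {x, y} in turn.  (Opaque: the proof searches Fin n, and a match on the result
-- must not unfold that search.)
opaque
  three-members : ∀ {n} (τ : Subset n) → ∣ τ ∣ ≡ 3 → Distinct₃ τ
  three-members {n} τ ∣τ∣≡3 = members
    where
    outside : ∀ q → ∣ q ∣ < 3 → ∃[ x ] (x ∈ τ × x ∉ q)
    outside q ∣q∣<3 = outside-smaller τ q (subst (∣ q ∣ <_) (sym ∣τ∣≡3) ∣q∣<3)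

    members : Distinct₃ τ
    members with outside ∅ (subst (_< 3) (sym (∣⊥∣≡0 n)) (s≤s z≤n))
    ... | x , x∈τ , _ with outside ⁅ x ⁆ (subst (_< 3) (sym (∣⁅x⁆∣≡1 x)) (s≤s (s≤s z≤n)))
    ... | y , y∈τ , y∉x with outside (⁅ x ⁆ ∪ ⁅ y ⁆)
                                 (≤-trans (s≤s (∣p∪q∣≤∣p∣+∣q∣ ⁅ x ⁆ ⁅ y ⁆))
                                   (≤-reflexive (cong suc (cong₂ _+_ (∣⁅x⁆∣≡1 x) (∣⁅x⁆∣≡1 y)))))
    ... | z , z∈τ , z∉xy =
      x , y , z , x∈τ , y∈τ , z∈τ ,
      (λ { refl → y∉x (x∈⁅x⁆ x) }) ,
      (λ { refl → z∉xy (x∈p∪q⁺ (inj₁ (x∈⁅x⁆ x))) }) ,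
      (λ { refl → z∉xy (x∈p∪q⁺ (inj₂ (x∈⁅x⁆ y))) })

∉⋃⁺ : ∀ {n} {x : Fin n} (σ : List (Subset n)) → All (x ∉_) σ → x ∉ foldr _∪_ ∅ σ
∉⋃⁺ [] [] m = ∉⊥ m
∉⋃⁺ (α ∷ σ) (x∉α ∷ rest) m with x∈p∪q⁻ α _ m
... | inj₁ x∈α = x∉α x∈α
... | inj₂ x∈⋃ = ∉⋃⁺ σ rest x∈⋃

∉⋃⁻ : ∀ {n} {x : Fin n} (σ : List (Subset n)) → x ∉ foldr _∪_ ∅ σ → All (x ∉_) σ
∉⋃⁻ [] _ = []
∉⋃⁻ (α ∷ σ) x∉ = (λ m → x∉ (x∈p∪q⁺ (inj₁ m))) ∷ ∉⋃⁻ σ (λ m → x∉ (x∈p∪q⁺ (inj₂ m)))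

[m%d+j]%d≡[m+j]%d : ∀ m j d .{{_ : NonZero d}} → (m % d + j) % d ≡ (m + j) % d
[m%d+j]%d≡[m+j]%d m j d = begin
  (m % d + j) % d          ≡⟨ %-distribˡ-+ (m % d) j d ⟩
  (m % d % d + j % d) % d  ≡⟨ cong (λ z → (z + j % d) % d) (m%n%n≡m%n m d) ⟩
  (m % d + j % d) % d      ≡⟨ %-distribˡ-+ m j d ⟨
  (m + j) % d              ∎
  where open ≡-Reasoning

-- The cycle ℤ/(k+6): its points are Fin (N k), the point named t being el k t.
module Cycle (k : ℕ) where

  n : ℕ
  n = N k

  Pt : Set
  Pt = Fin n

  el-toℕ : ∀ t → toℕ (el k t) ≡ (t + (5 + k)) % n
  el-toℕ t = toℕ-fromℕ< _

  el-suc-toℕ : ∀ m → toℕ (el k (suc m)) ≡ m % n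
  el-suc-toℕ m = begin
    toℕ (el k (suc m))      ≡⟨ el-toℕ (suc m) ⟩
    (suc m + (5 + k)) % n   ≡⟨ cong (_% n) (+-suc m (5 + k)) ⟨
    (m + n) % n             ≡⟨ [m+n]%n≡m%n m n ⟩
    m % n                   ∎
    where open ≡-Reasoning

  label : Pt → ℕ
  label x = suc (toℕ x)

  label-range : ∀ x → InRange n (label x)
  label-range x = s≤s z≤n , toℕ<n x

  el-label : ∀ x → el k (label x) ≡ x
  el-label x = toℕ-injective (trans (el-suc-toℕ (toℕ x)) (m<n⇒m%n≡m (toℕ<n x)))

  label-el : ∀ {t} → InRange n t → label (el k t) ≡ t
  label-el {suc t} (_ , t<n) = cong suc (trans (el-suc-toℕ t) (m<n⇒m%n≡m t<n))

  el-injective : ∀ {t t′} → InRange n t → InRange n t′ → el k t ≡ el k t′ → t ≡ t′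
  el-injective {t} {t′} r r′ e = begin
    t                ≡⟨ label-el r ⟨
    label (el k t)   ≡⟨ cong label e ⟩
    label (el k t′)  ≡⟨ label-el r′ ⟩
    t′               ∎
    where open ≡-Reasoning

  el-wrap : el k n ≡ el k 0
  el-wrap = toℕ-injective (trans (el-suc-toℕ (5 + k)) (sym (el-toℕ 0)))

  -- Cyclic successor x⁺ and predecessor x⁻.  They are kept opaque so that
  -- the modular arithmetic behind them is never unfolded during type checking.
  opaque
    next : Pt → Pt
    next x = el k (suc (label x))

    prev : Pt → Pt
    prev x = el k (toℕ x)

    next-def : ∀ x → next x ≡ el k (suc (label x))
    next-def x = refl

    prev-def : ∀ x → prev x ≡ el k (toℕ x)
    prev-def x = refl

  next-toℕ : ∀ x → toℕ (next x) ≡ suc (toℕ x) % n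
  next-toℕ x = trans (cong toℕ (next-def x)) (el-suc-toℕ (suc (toℕ x)))

  prev-toℕ : ∀ x → toℕ (prev x) ≡ (toℕ x + (5 + k)) % n
  prev-toℕ x = trans (cong toℕ (prev-def x)) (el-toℕ (toℕ x))

  next-prev : ∀ x → next (prev x) ≡ x
  next-prev x = toℕ-injective (begin
    toℕ (next (prev x))                  ≡⟨ next-toℕ (prev x) ⟩
    suc (toℕ (prev x)) % n               ≡⟨ cong (λ z → suc z % n) (prev-toℕ x) ⟩
    (1 + (toℕ x + (5 + k)) % n) % n      ≡⟨ cong (_% n) (+-comm 1 ((toℕ x + (5 + k)) % n)) ⟩
    ((toℕ x + (5 + k)) % n + 1) % n      ≡⟨ [m%d+j]%d≡[m+j]%d (toℕ x + (5 + k)) 1 n ⟩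
    (toℕ x + (5 + k) + 1) % n            ≡⟨ cong (_% n) (trans (+-assoc (toℕ x) (5 + k) 1)
                                              (cong (toℕ x +_) (+-comm (5 + k) 1))) ⟩
    (toℕ x + n) % n                      ≡⟨ [m+n]%n≡m%n (toℕ x) n ⟩
    toℕ x % n                            ≡⟨ m<n⇒m%n≡m (toℕ<n x) ⟩
    toℕ x                                ∎)
    where open ≡-Reasoning

  prev-next : ∀ x → prev (next x) ≡ x
  prev-next x = toℕ-injective (begin
    toℕ (prev (next x))                  ≡⟨ prev-toℕ (next x) ⟩
    (toℕ (next x) + (5 + k)) % n         ≡⟨ cong (λ z → (z + (5 + k)) % n) (next-toℕ x) ⟩
    (suc (toℕ x) % n + (5 + k)) % n      ≡⟨ [m%d+j]%d≡[m+j]%d (suc (toℕ x)) (5 + k) n ⟩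
    (suc (toℕ x) + (5 + k)) % n          ≡⟨ cong (_% n) (+-suc (toℕ x) (5 + k)) ⟨
    (toℕ x + n) % n                      ≡⟨ [m+n]%n≡m%n (toℕ x) n ⟩
    toℕ x % n                            ≡⟨ m<n⇒m%n≡m (toℕ<n x) ⟩
    toℕ x                                ∎)
    where open ≡-Reasoning

  next-injective : ∀ {x y} → next x ≡ next y → x ≡ y
  next-injective {x} {y} e = trans (sym (prev-next x)) (trans (cong prev e) (prev-next y))

  next⇒prev : ∀ {x y} → y ≡ next x → x ≡ prev y
  next⇒prev {x} refl = sym (prev-next x)

  prev⇒next : ∀ {x y} → y ≡ prev x → x ≡ next y
  prev⇒next {x} refl = sym (next-prev x)

  el-next : ∀ {t} → InRange n t → el k (suc t) ≡ next (el k t)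
  el-next {t} r = trans (cong (λ z → el k (suc z)) (sym (label-el r))) (sym (next-def (el k t)))

  el-prev : ∀ {t} → InRange n t → el k (t ∸ 1) ≡ prev (el k t)
  el-prev {t} r = trans (cong (λ z → el k (z ∸ 1)) (sym (label-el r))) (sym (prev-def (el k t)))

  el-label-next : ∀ x → el k (suc (label x)) ≡ next x
  el-label-next x = sym (next-def x)

  el-label-prev : ∀ x → el k (label x ∸ 1) ≡ prev x
  el-label-prev x = sym (prev-def x)

  next^ : ℕ → Pt → Pt
  next^ zero x = x
  next^ (suc m) x = next (next^ m x)

  next^-toℕ : ∀ m x → toℕ (next^ m x) ≡ (toℕ x + m) % n
  next^-toℕ zero x = sym (trans (cong (_% n) (+-identityʳ (toℕ x))) (m<n⇒m%n≡m (toℕ<n x)))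
  next^-toℕ (suc m) x = begin
    toℕ (next (next^ m x))        ≡⟨ next-toℕ (next^ m x) ⟩
    (1 + toℕ (next^ m x)) % n     ≡⟨ cong (λ z → (1 + z) % n) (next^-toℕ m x) ⟩
    (1 + (toℕ x + m) % n) % n     ≡⟨ cong (_% n) (+-comm 1 ((toℕ x + m) % n)) ⟩
    ((toℕ x + m) % n + 1) % n     ≡⟨ [m%d+j]%d≡[m+j]%d (toℕ x + m) 1 n ⟩
    (toℕ x + m + 1) % n           ≡⟨ cong (_% n) (trans (+-assoc (toℕ x) m 1)
                                                          (cong (toℕ x +_) (+-comm m 1))) ⟩
    (toℕ x + suc m) % n           ∎
    where open ≡-Reasoning

  -- The cycle has length k + 6 ≥ 6, so 1 ≤ m ≤ 5 steps never return to the start: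
  -- (x + m) mod n = x would make m a multiple of n.
  no-short-cycle : ∀ m x → 1 ≤ m → m ≤ 5 → next^ m x ≢ x
  no-short-cycle m x 1≤m m≤5 e = multiple ((toℕ x + m) / n) (begin
    toℕ x + m                             ≡⟨ m≡m%n+[m/n]*n (toℕ x + m) n ⟩
    (toℕ x + m) % n + (toℕ x + m) / n * n ≡⟨ cong (_+ (toℕ x + m) / n * n) returns ⟩
    toℕ x + (toℕ x + m) / n * n           ∎)
    where
    open ≡-Reasoning
    returns : (toℕ x + m) % n ≡ toℕ x
    returns = trans (sym (next^-toℕ m x)) (cong toℕ e)
    m<n : m < n
    m<n = s≤s (≤-trans m≤5 (m≤m+n 5 k))
    multiple : ∀ q → toℕ x + m ≢ toℕ x + q * n
    multiple zero h = <-irrefl (sym (+-cancelˡ-≡ (toℕ x) m 0 h)) 1≤m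
    multiple (suc q) h = <-irrefl refl (≤-trans m<n (≤-trans (m≤m+n n (q * n))
      (≤-reflexive (sym (+-cancelˡ-≡ (toℕ x) m (n + q * n) h)))))

  x⁺≢x : ∀ x → next x ≢ x
  x⁺≢x x = no-short-cycle 1 x (s≤s z≤n) (s≤s z≤n)

  x⁺⁺≢x : ∀ x → next (next x) ≢ x
  x⁺⁺≢x x = no-short-cycle 2 x (s≤s z≤n) (s≤s (s≤s z≤n))

  x⁺³≢x : ∀ x → next (next (next x)) ≢ x
  x⁺³≢x x = no-short-cycle 3 x (s≤s z≤n) (s≤s (s≤s (s≤s z≤n)))

  x⁺⁴≢x : ∀ x → next (next (next (next x))) ≢ x
  x⁺⁴≢x x = no-short-cycle 4 x (s≤s z≤n) (s≤s (s≤s (s≤s (s≤s z≤n))))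

  x⁺⁵≢x : ∀ x → next (next (next (next (next x)))) ≢ x
  x⁺⁵≢x x = no-short-cycle 5 x (s≤s z≤n) (s≤s (s≤s (s≤s (s≤s (s≤s z≤n)))))

-- Points of the cycle: adjacency, and the structure of sets without an
-- independent triple.
module Structure (k : ℕ) where
  open Cycle k

  Adjacent : Pt → Pt → Set
  Adjacent x y = y ≡ next x ⊎ x ≡ next y

  adjacent? : ∀ x y → Dec (Adjacent x y)
  adjacent? x y = (y ≟ next x) ⊎-dec (x ≟ next y)

  adjacent-sym : ∀ {x y} → Adjacent x y → Adjacent y x
  adjacent-sym (inj₁ e) = inj₂ e
  adjacent-sym (inj₂ e) = inj₁ e

  left-of : ∀ {y a} → Adjacent y a → y ≢ next a → y ≡ prev a
  left-of (inj₁ a≡y⁺) _ = next⇒prev a≡y⁺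
  left-of (inj₂ y≡a⁺) y≢a⁺ = ⊥-elim (y≢a⁺ y≡a⁺)

  right-of : ∀ {y a} → Adjacent y (next a) → y ≢ a → y ≡ next (next a)
  right-of (inj₁ a⁺≡y⁺) y≢a = ⊥-elim (y≢a (sym (next-injective a⁺≡y⁺)))
  right-of (inj₂ y≡a⁺⁺) _ = y≡a⁺⁺

  -- Apart a b:  b ∉ {a⁻, a, a⁺}, the condition on the extra point b in both shapes.
  Apart : Pt → Pt → Set
  Apart a b = b ≢ prev a × b ≢ a × b ≢ next a

  apart : ∀ {a b} → b ≢ a → ¬ Adjacent a b → Apart a b
  apart b≢a ¬ab = (λ e → ¬ab (inj₂ (prev⇒next e))) , b≢a , (λ e → ¬ab (inj₁ e))

  apart-sym : ∀ {a b} → Apart a b → Apart b a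
  apart-sym (b≢a⁻ , b≢a , b≢a⁺) =
    (λ e → b≢a⁺ (prev⇒next e)) , b≢a ∘ sym , (λ e → b≢a⁻ (next⇒prev e))

  -- Points two steps apart are not adjacent (the cycle has length ≥ 6).
  ¬adjacent-next² : ∀ x → ¬ Adjacent x (next (next x))
  ¬adjacent-next² x (inj₁ e) = x⁺≢x x (next-injective e)
  ¬adjacent-next² x (inj₂ e) = x⁺³≢x x (sym e)

  apart-next² : ∀ x → Apart x (next (next x))
  apart-next² x = apart (x⁺⁺≢x x) (¬adjacent-next² x)

  -- Three distinct, pairwise non-adjacent points of C, i.e. a stable 3-subset of C.
  IndependentTriple : Subset n → Set
  IndependentTriple C = Σ Pt λ x → Σ Pt λ y → Σ Pt λ z →
    x ∈ C × y ∈ C × z ∈ C × x ≢ y × x ≢ z × y ≢ z ×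
    ¬ Adjacent x y × ¬ Adjacent x z × ¬ Adjacent y z

  -- (Opaque: the search over all triples must never be unfolded symbolically.)
  opaque
    independent-triple? : ∀ C → Dec (IndependentTriple C)
    independent-triple? C = any? λ x → any? λ y → any? λ z →
      (x ∈? C) ×-dec (y ∈? C) ×-dec (z ∈? C) ×-dec ¬? (x ≟ y) ×-dec ¬? (x ≟ z) ×-dec ¬? (y ≟ z) ×-dec
      ¬? (adjacent? x y) ×-dec ¬? (adjacent? x z) ×-dec ¬? (adjacent? y z)

  -- The two possible shapes of a set with ≥ 3 points and no independent triple:
  -- {a, a⁺, b} or {a, a⁺, b, b⁺}, with b ∉ {a⁻, a, a⁺}.
  data Shape (C : Subset n) : Set where
    pair+point : ∀ a b → Apart a b → C ≡ set₃ a (next a) b → Shape C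
    two-pairs  : ∀ a b → Apart a b → C ≡ set₄ a (next a) b (next b) → Shape C

  module WithoutIndependentTriple {C : Subset n} (free : ¬ IndependentTriple C) where

    adjacent-to-one : ∀ {u v w} → u ∈ C → v ∈ C → w ∈ C → u ≢ v → u ≢ w → v ≢ w →
                      ¬ Adjacent u v → Adjacent w u ⊎ Adjacent w v
    adjacent-to-one {u} {v} {w} u∈ v∈ w∈ u≢v u≢w v≢w ¬uv with adjacent? w u | adjacent? w v
    ... | yes wu | _ = inj₁ wu
    ... | no _ | yes wv = inj₂ wv
    ... | no ¬wu | no ¬wv = ⊥-elim (free (u , v , w , u∈ , v∈ , w∈ , u≢v , u≢w , v≢w , ¬uv ,
                                         ¬wu ∘ adjacent-sym , ¬wv ∘ adjacent-sym))

    -- Four consecutive points c, …, c⁺³ in C leave room for nothing else: a fifth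
    -- point would be adjacent to c or c⁺² (so it is c⁻) and to c⁺ or c⁺³ (so it
    -- is c⁺⁴), closing a cycle of length 5.
    four-consecutive : ∀ c → c ∈ C → next c ∈ C → next (next c) ∈ C → next (next (next c)) ∈ C →
                       Shape C
    four-consecutive c c∈ c⁺∈ c⁺²∈ c⁺³∈ =
      two-pairs c (next (next c)) (apart-next² c) (set₄-exact c∈ c⁺∈ c⁺²∈ c⁺³∈ (by-exclusion₄ no-fifth))
      where
      no-fifth : ∀ {w} → w ∈ C → w ≢ c → w ≢ next c → w ≢ next (next c) →
                 w ≢ next (next (next c)) → ⊥
      no-fifth {w} w∈ w≢c w≢c⁺ w≢c⁺² w≢c⁺³ = x⁺⁵≢x c (begin
          next (next (next (next (next c))))  ≡⟨ cong next w≡c⁺⁴ ⟨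
          next w                              ≡⟨ cong next w≡c⁻ ⟩
          next (prev c)                       ≡⟨ next-prev c ⟩
          c                                   ∎)
        where
        open ≡-Reasoning
        w≡c⁻ : w ≡ prev c
        w≡c⁻ with adjacent-to-one c∈ c⁺²∈ w∈ (≢-sym (x⁺⁺≢x c)) (≢-sym w≢c) (≢-sym w≢c⁺²) (¬adjacent-next² c)
        ... | inj₁ wc = left-of wc w≢c⁺
        ... | inj₂ wc⁺² = ⊥-elim (w≢c⁺ (trans (left-of wc⁺² w≢c⁺³) (prev-next (next c))))
        w≡c⁺⁴ : w ≡ next (next (next (next c)))
        w≡c⁺⁴ with adjacent-to-one c⁺∈ c⁺³∈ w∈ (≢-sym (x⁺⁺≢x (next c))) (≢-sym w≢c⁺) (≢-sym w≢c⁺³)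
                                    (¬adjacent-next² (next c))
        ... | inj₁ wc⁺ = ⊥-elim (w≢c (trans (left-of wc⁺ w≢c⁺²) (prev-next c)))
        ... | inj₂ wc⁺³ = right-of wc⁺³ w≢c⁺²

    -- A pair {a, a⁺} in C that does not extend to four consecutive points.
    module AroundPair {a} (a∈ : a ∈ C) (a⁺∈ : next a ∈ C)
                      (not-both : ¬ (prev a ∈ C × next (next a) ∈ C)) where

      -- The points of C off {a, a⁺} are pairwise adjacent: a non-adjacent pair
      -- y, z would force a neighbour of a other than a⁺ (hence a⁻) and a neighbour
      -- of a⁺ other than a (hence a⁺⁺) into C.
      off-pair-adjacent : ∀ {y z} → y ∈ C → z ∈ C → y ≢ a → y ≢ next a → z ≢ a → z ≢ next a → y ≢ z →
                          Adjacent y z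
      off-pair-adjacent {y} {z} y∈ z∈ y≢a y≢a⁺ z≢a z≢a⁺ y≢z with adjacent? y z
      ... | yes yz = yz
      ... | no ¬yz = ⊥-elim (not-both (a⁻∈ , a⁺⁺∈))
        where
        a⁻∈ : prev a ∈ C
        a⁻∈ = [ (λ ay → subst (_∈ C) (left-of (adjacent-sym ay) y≢a⁺) y∈)
              , (λ az → subst (_∈ C) (left-of (adjacent-sym az) z≢a⁺) z∈) ]′
                (adjacent-to-one y∈ z∈ a∈ y≢z y≢a z≢a ¬yz)
        a⁺⁺∈ : next (next a) ∈ C
        a⁺⁺∈ = [ (λ a⁺y → subst (_∈ C) (right-of (adjacent-sym a⁺y) y≢a) y∈)
               , (λ a⁺z → subst (_∈ C) (right-of (adjacent-sym a⁺z) z≢a) z∈) ]′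
                 (adjacent-to-one y∈ z∈ a⁺∈ y≢z y≢a⁺ z≢a⁺ ¬yz)

      -- A second pair {d, d⁺} in C off {a, a⁺}: then C = {a, a⁺, d, d⁺}, since a
      -- further point would be adjacent to d (so d⁻) and to d⁺ (so d⁺⁺).
      with-second-pair : ∀ {d} → d ∈ C → next d ∈ C → d ≢ a → d ≢ next a → next d ≢ a → next d ≢ next a →
                         Shape C
      with-second-pair {d} d∈ d⁺∈ d≢a d≢a⁺ d⁺≢a d⁺≢a⁺ =
        two-pairs a d ((λ e → d⁺≢a (sym (prev⇒next e))) , d≢a , d≢a⁺)
                  (set₄-exact a∈ a⁺∈ d∈ d⁺∈ (by-exclusion₄ no-fifth))
        where
        no-fifth : ∀ {w} → w ∈ C → w ≢ a → w ≢ next a → w ≢ d → w ≢ next d → ⊥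
        no-fifth {w} w∈ w≢a w≢a⁺ w≢d w≢d⁺ = x⁺³≢x d (begin
            next (next (next d))  ≡⟨ cong next w≡d⁺⁺ ⟨
            next w                ≡⟨ cong next w≡d⁻ ⟩
            next (prev d)         ≡⟨ next-prev d ⟩
            d                     ∎)
          where
          open ≡-Reasoning
          w≡d⁻ : w ≡ prev d
          w≡d⁻ = left-of (off-pair-adjacent w∈ d∈ w≢a w≢a⁺ d≢a d≢a⁺ w≢d) w≢d⁺
          w≡d⁺⁺ : w ≡ next (next d)
          w≡d⁺⁺ = right-of (off-pair-adjacent w∈ d⁺∈ w≢a w≢a⁺ d⁺≢a d⁺≢a⁺ w≢d⁺) w≢d

      -- C = {a, a⁺, c}.  If c = a⁻ the pair is re-chosen as {a⁻, a}, so that the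
      -- single point a⁺ is apart from it.
      pair-and-point : ∀ {c} → c ∈ C → c ≢ a → c ≢ next a →
                       (∀ {w} → w ∈ C → w ≢ a → w ≢ next a → w ≢ c → ⊥) → Shape C
      pair-and-point {c} c∈ c≢a c≢a⁺ none with c ≟ prev a
      ... | no c≢a⁻ = pair+point a c (c≢a⁻ , c≢a , c≢a⁺) (set₃-exact a∈ a⁺∈ c∈ (by-exclusion₃ none))
      ... | yes refl = pair+point c (next a) (subst (Apart c) (cong next (next-prev a)) (apart-next² c))
                         (set₃-exact c∈ (subst (_∈ C) (sym (next-prev a)) a∈) a⁺∈ (by-exclusion₃ none′))
        where
        none′ : ∀ {w} → w ∈ C → w ≢ c → w ≢ next c → w ≢ next a → ⊥
        none′ w∈ w≢c w≢c⁺ w≢a⁺ = none w∈ (λ e → w≢c⁺ (trans e (sym (next-prev a)))) w≢a⁺ w≢c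

      with-third-point : ∀ {c} → c ∈ C → c ≢ a → c ≢ next a → Shape C
      with-third-point {c} c∈ c≢a c≢a⁺
        with (next c ∈? C) ×-dec ¬? (next c ≟ a) ×-dec ¬? (next c ≟ next a)
      ... | yes (c⁺∈ , c⁺≢a , c⁺≢a⁺) = with-second-pair c∈ c⁺∈ c≢a c≢a⁺ c⁺≢a c⁺≢a⁺
      ... | no no-right with (prev c ∈? C) ×-dec ¬? (prev c ≟ a) ×-dec ¬? (prev c ≟ next a)
      ...   | yes (c⁻∈ , c⁻≢a , c⁻≢a⁺) =
              with-second-pair c⁻∈ (subst (_∈ C) (sym (next-prev c)) c∈) c⁻≢a c⁻≢a⁺
                               (c≢a ∘ trans (sym (next-prev c))) (c≢a⁺ ∘ trans (sym (next-prev c)))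
      ...   | no no-left = pair-and-point c∈ c≢a c≢a⁺ none
        where
        none : ∀ {w} → w ∈ C → w ≢ a → w ≢ next a → w ≢ c → ⊥
        none {w} w∈ w≢a w≢a⁺ w≢c with off-pair-adjacent w∈ c∈ w≢a w≢a⁺ c≢a c≢a⁺ w≢c
        ... | inj₁ c≡w⁺ = no-left (subst (_∈ C) (next⇒prev c≡w⁺) w∈ ,
                                   w≢a ∘ trans (next⇒prev c≡w⁺) , w≢a⁺ ∘ trans (next⇒prev c≡w⁺))
        ... | inj₂ w≡c⁺ = no-right (subst (_∈ C) w≡c⁺ w∈ , w≢a ∘ trans w≡c⁺ , w≢a⁺ ∘ trans w≡c⁺)

    pair-and-third : ∀ {a c} → a ∈ C → next a ∈ C → c ∈ C → c ≢ a → c ≢ next a → Shape C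
    pair-and-third {a} a∈ a⁺∈ c∈ c≢a c≢a⁺ with (prev a ∈? C) ×-dec (next (next a) ∈? C)
    ... | no not-both = AroundPair.with-third-point a∈ a⁺∈ not-both c∈ c≢a c≢a⁺
    ... | yes (a⁻∈ , a⁺⁺∈) = four-consecutive (prev a) a⁻∈ (shift (λ x → x ∈ C) a∈)
                               (shift (λ x → next x ∈ C) a⁺∈) (shift (λ x → next (next x) ∈ C) a⁺⁺∈)
      where
      shift : (P : Pt → Set) → P a → P (next (prev a))
      shift P = subst P (sym (next-prev a))

    from-adjacent : ∀ {u v c} → u ∈ C → v ∈ C → Adjacent u v → c ∈ C → c ≢ u → c ≢ v → Shape C
    from-adjacent u∈ v∈ (inj₁ v≡u⁺) c∈ c≢u c≢v =
      pair-and-third u∈ (subst (_∈ C) v≡u⁺ v∈) c∈ c≢u (λ e → c≢v (trans e (sym v≡u⁺)))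
    from-adjacent u∈ v∈ (inj₂ u≡v⁺) c∈ c≢u c≢v =
      pair-and-third v∈ (subst (_∈ C) u≡v⁺ u∈) c∈ c≢v (λ e → c≢u (trans e (sym u≡v⁺)))

    structure : ∀ {x y z} → x ∈ C → y ∈ C → z ∈ C → x ≢ y → x ≢ z → y ≢ z → Shape C
    structure {x} {y} {z} x∈ y∈ z∈ x≢y x≢z y≢z with adjacent? x y | adjacent? x z | adjacent? y z
    ... | yes xy | _ | _ = from-adjacent x∈ y∈ xy z∈ (≢-sym x≢z) (≢-sym y≢z)
    ... | no _ | yes xz | _ = from-adjacent x∈ z∈ xz y∈ (≢-sym x≢y) y≢z
    ... | no _ | no _ | yes yz = from-adjacent y∈ z∈ yz x∈ x≢y x≢z
    ... | no ¬xy | no ¬xz | no ¬yz =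
      ⊥-elim (free (_ , _ , _ , x∈ , y∈ , z∈ , x≢y , x≢z , y≢z , ¬xy , ¬xz , ¬yz))

-- The shapes determine their parameters: b ∉ {a⁻, a, a⁺} pins down which
-- consecutive pair of the set is {a, a⁺}.
module Uniqueness (k : ℕ) where
  open Cycle k
  open Structure k

  -- {a′, a′⁺, b′} ⊆ {a, a⁺, b} forces a′ = a and b′ = b: if a′ = a⁺ then b = a⁺⁺
  -- and b′ has no place left; if a′ = b then b⁺ has no place.
  pair+point-unique : ∀ {a b a′ b′} → Apart a b → Apart a′ b′ →
                      (∀ {w} → OneOf₃ w a′ (next a′) b′ → OneOf₃ w a (next a) b) → a ≡ a′ × b ≡ b′
  pair+point-unique {a} (b≢a⁻ , b≢a , b≢a⁺) (b′≢a′⁻ , b′≢a′ , b′≢a′⁺) within with within (inj₁ refl)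
  ... | inj₁ refl with within (inj₂ (inj₂ refl))
  ...   | inj₁ b′≡a = ⊥-elim (b′≢a′ b′≡a)
  ...   | inj₂ (inj₁ b′≡a⁺) = ⊥-elim (b′≢a′⁺ b′≡a⁺)
  ...   | inj₂ (inj₂ b′≡b) = refl , sym b′≡b
  pair+point-unique {a} (b≢a⁻ , b≢a , b≢a⁺) (b′≢a′⁻ , b′≢a′ , b′≢a′⁺) within | inj₂ (inj₁ refl)
    with within (inj₂ (inj₁ refl))
  ...   | inj₁ a⁺⁺≡a = ⊥-elim (x⁺⁺≢x a a⁺⁺≡a)
  ...   | inj₂ (inj₁ a⁺⁺≡a⁺) = ⊥-elim (x⁺≢x a (next-injective a⁺⁺≡a⁺))
  ...   | inj₂ (inj₂ a⁺⁺≡b) with within (inj₂ (inj₂ refl))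
  ...     | inj₁ b′≡a = ⊥-elim (b′≢a′⁻ (trans b′≡a (sym (prev-next a))))
  ...     | inj₂ (inj₁ b′≡a⁺) = ⊥-elim (b′≢a′ b′≡a⁺)
  ...     | inj₂ (inj₂ b′≡b) = ⊥-elim (b′≢a′⁺ (trans b′≡b (sym a⁺⁺≡b)))
  pair+point-unique {a} {b} (b≢a⁻ , b≢a , b≢a⁺) _ within | inj₂ (inj₂ refl)
    with within (inj₂ (inj₁ refl))
  ...   | inj₁ b⁺≡a = ⊥-elim (b≢a⁻ (next⇒prev (sym b⁺≡a)))
  ...   | inj₂ (inj₁ b⁺≡a⁺) = ⊥-elim (b≢a (next-injective b⁺≡a⁺))
  ...   | inj₂ (inj₂ b⁺≡b) = ⊥-elim (x⁺≢x b b⁺≡b)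

  same-first-pair : ∀ {a b b′} → Apart a b′ →
                    (∀ {w} → OneOf₄ w a (next a) b′ (next b′) → OneOf₄ w a (next a) b (next b)) → b′ ≡ b
  same-first-pair {a} {b} {b′} (b′≢a⁻ , b′≢a , b′≢a⁺) within with within (inj₂ (inj₂ (inj₁ refl)))
  ... | inj₁ b′≡a = ⊥-elim (b′≢a b′≡a)
  ... | inj₂ (inj₁ b′≡a⁺) = ⊥-elim (b′≢a⁺ b′≡a⁺)
  ... | inj₂ (inj₂ (inj₁ b′≡b)) = b′≡b
  ... | inj₂ (inj₂ (inj₂ refl)) with within (inj₂ (inj₂ (inj₂ refl)))
  ...   | inj₁ b⁺⁺≡a = ⊥-elim (b′≢a⁻ (next⇒prev (sym b⁺⁺≡a)))
  ...   | inj₂ (inj₁ b⁺⁺≡a⁺) = ⊥-elim (b′≢a (next-injective b⁺⁺≡a⁺))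
  ...   | inj₂ (inj₂ (inj₁ b⁺⁺≡b)) = ⊥-elim (x⁺⁺≢x b b⁺⁺≡b)
  ...   | inj₂ (inj₂ (inj₂ b⁺⁺≡b⁺)) = ⊥-elim (x⁺≢x (next b) b⁺⁺≡b⁺)

  -- … and no pair of it starts at a⁺: that would force b = a⁺⁺ and then a fifth
  -- consecutive point a⁺⁴ into a set of four points on a cycle of length ≥ 6.
  no-shifted-pair : ∀ {a b b′} → Apart a b → Apart (next a) b′ →
                    (∀ {w} → OneOf₄ w (next a) (next (next a)) b′ (next b′) → OneOf₄ w a (next a) b (next b)) →
                    ⊥
  no-shifted-pair {a} (b≢a⁻ , b≢a , b≢a⁺) (b′≢a , b′≢a⁺ , b′≢a⁺⁺) within with within (inj₂ (inj₁ refl))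
  ... | inj₁ a⁺⁺≡a = x⁺⁺≢x a a⁺⁺≡a
  ... | inj₂ (inj₁ a⁺⁺≡a⁺) = x⁺≢x a (next-injective a⁺⁺≡a⁺)
  ... | inj₂ (inj₂ (inj₂ a⁺⁺≡b⁺)) = b≢a⁺ (sym (next-injective a⁺⁺≡b⁺))
  ... | inj₂ (inj₂ (inj₁ refl)) with within (inj₂ (inj₂ (inj₁ refl)))
  ...   | inj₁ b′≡a = b′≢a (trans b′≡a (sym (prev-next a)))
  ...   | inj₂ (inj₁ b′≡a⁺) = b′≢a⁺ b′≡a⁺
  ...   | inj₂ (inj₂ (inj₁ b′≡a⁺⁺)) = b′≢a⁺⁺ b′≡a⁺⁺
  ...   | inj₂ (inj₂ (inj₂ refl)) with within (inj₂ (inj₂ (inj₂ refl)))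
  ...     | inj₁ a⁺⁴≡a = x⁺⁴≢x a a⁺⁴≡a
  ...     | inj₂ (inj₁ a⁺⁴≡a⁺) = x⁺³≢x a (next-injective a⁺⁴≡a⁺)
  ...     | inj₂ (inj₂ (inj₁ a⁺⁴≡a⁺⁺)) = x⁺⁺≢x (next (next a)) a⁺⁴≡a⁺⁺
  ...     | inj₂ (inj₂ (inj₂ a⁺⁴≡a⁺³)) = x⁺≢x (next (next (next a))) a⁺⁴≡a⁺³

  -- The two pairs of a set of shape {a, a⁺, b, b⁺} are determined up to order:
  -- a′ is a, a⁺, b or b⁺, and the cases a⁺, b⁺ are excluded by no-shifted-pair.
  two-pairs-unique : ∀ {a b a′ b′} → Apart a b → Apart a′ b′ →
                     (∀ {w} → OneOf₄ w a′ (next a′) b′ (next b′) → OneOf₄ w a (next a) b (next b)) →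
                     (a ≡ a′ × b ≡ b′) ⊎ (a ≡ b′ × b ≡ a′)
  two-pairs-unique apart₁ apart₂ within with within (inj₁ refl)
  ... | inj₁ refl = inj₁ (refl , sym (same-first-pair apart₂ within))
  ... | inj₂ (inj₁ refl) = ⊥-elim (no-shifted-pair apart₁ apart₂ within)
  ... | inj₂ (inj₂ (inj₁ refl)) = inj₂ (sym (same-first-pair apart₂ (λ m → OneOf₄-swap (within m))) , refl)
  ... | inj₂ (inj₂ (inj₂ refl)) =
    ⊥-elim (no-shifted-pair (apart-sym apart₁) apart₂ (λ m → OneOf₄-swap (within m)))

-- The neighbourhood complexes, described through the complement C_σ.
module Complexes (k : ℕ) where
  open Cycle k
  open Structure k

  HasConsecutive : Subset n → Set
  HasConsecutive v = Σ Pt λ x → x ∈ v × next x ∈ v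

  stable⇒¬consecutive : ∀ {v} → Stable k v → ¬ HasConsecutive v
  stable⇒¬consecutive {v} stable (x , x∈ , x⁺∈) =
    stable (label x , label-range x , subst (_∈ v) (sym (el-label x)) x∈ ,
            subst (_∈ v) (sym (el-label-next x)) x⁺∈)

  ¬consecutive⇒stable : ∀ {v} → ¬ HasConsecutive v → Stable k v
  ¬consecutive⇒stable {v} none (t , t∈[n] , t∈ , t⁺∈) =
    none (el k t , t∈ , subst (_∈ v) (el-next t∈[n]) t⁺∈)

  -- Stability is decidable (opaque for the same reason as three-members).
  opaque
    stable? : ∀ v → Dec (Stable k v)
    stable? v with any? (λ x → (x ∈? v) ×-dec (next x ∈? v))
    ... | yes consecutive = no (λ stable → stable⇒¬consecutive stable consecutive)
    ... | no none = yes (¬consecutive⇒stable none)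

  ∈C⁺ : ∀ {σ x} → All (x ∉_) σ → x ∈ C k σ
  ∈C⁺ {σ} x∉ = x∉p⇒x∈∁p (∉⋃⁺ σ x∉)

  ∈C⁻ : ∀ {σ x} → x ∈ C k σ → All (x ∉_) σ
  ∈C⁻ {σ} x∈ = ∉⋃⁻ σ (x∈∁p⇒x∉p x∈)

  neighbour⊆C : ∀ {σ τ} → All (λ α → AdjKG k α τ) σ → τ ⊆ C k σ
  neighbour⊆C adj x∈τ = ∈C⁺ (All.map (λ (_ , _ , disjoint) x∈α → disjoint _ x∈α x∈τ) adj)

  ⊆C⇒neighbour : ∀ {σ τ} → All (IsVertex k) σ → IsVertex k τ → τ ⊆ C k σ → All (λ α → AdjKG k α τ) σ
  ⊆C⇒neighbour [] _ _ = []
  ⊆C⇒neighbour {α ∷ σ} (α-vertex ∷ vertices) τ-vertex τ⊆C =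
    (α-vertex , τ-vertex , λ x x∈α x∈τ → All.head (∈C⁻ {α ∷ σ} (τ⊆C x∈τ)) x∈α)
    ∷ ⊆C⇒neighbour vertices τ-vertex (λ x∈τ → ∈C⁺ (All.tail (∈C⁻ {α ∷ σ} (τ⊆C x∈τ))))

  -- S_{3,k} is a subgraph of KG_{3,k}, so P₁ ⊆ P₃.
  P1⇒P3 : ∀ {σ} → P1 k σ → P3 k σ
  P1⇒P3 (vertices , nonempty , τ , τ-vertex , adj) =
    vertices , nonempty , τ , τ-vertex , All.map proj₁ adj

  stable⇒¬adjacent : ∀ {v x y} → Stable k v → x ∈ v → y ∈ v → ¬ Adjacent x y
  stable⇒¬adjacent {v} stable x∈ y∈ (inj₁ y≡x⁺) =
    stable⇒¬consecutive stable (_ , x∈ , subst (_∈ v) y≡x⁺ y∈)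
  stable⇒¬adjacent {v} stable x∈ y∈ (inj₂ x≡y⁺) =
    stable⇒¬consecutive stable (_ , y∈ , subst (_∈ v) x≡y⁺ x∈)

  independent-stable : ∀ {x y z} → ¬ Adjacent x y → ¬ Adjacent x z → ¬ Adjacent y z →
                       Stable k (set₃ x y z)
  independent-stable {x} {y} {z} ¬xy ¬xz ¬yz =
    ¬consecutive⇒stable (λ (u , u∈ , u⁺∈) → consecutive (∈set₃⇒ u∈) (∈set₃⇒ u⁺∈))
    where
    consecutive : ∀ {u} → OneOf₃ u x y z → OneOf₃ (next u) x y z → ⊥
    consecutive (inj₁ refl) (inj₁ e) = x⁺≢x x e
    consecutive (inj₁ refl) (inj₂ (inj₁ e)) = ¬xy (inj₁ (sym e))
    consecutive (inj₁ refl) (inj₂ (inj₂ e)) = ¬xz (inj₁ (sym e))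
    consecutive (inj₂ (inj₁ refl)) (inj₁ e) = ¬xy (inj₂ (sym e))
    consecutive (inj₂ (inj₁ refl)) (inj₂ (inj₁ e)) = x⁺≢x y e
    consecutive (inj₂ (inj₁ refl)) (inj₂ (inj₂ e)) = ¬yz (inj₁ (sym e))
    consecutive (inj₂ (inj₂ refl)) (inj₁ e) = ¬xz (inj₂ (sym e))
    consecutive (inj₂ (inj₂ refl)) (inj₂ (inj₁ e)) = ¬yz (inj₂ (sym e))
    consecutive (inj₂ (inj₂ refl)) (inj₂ (inj₂ e)) = x⁺≢x z e

  all-stable⇒P1 : ∀ {σ} → P3 k σ → All (Stable k) σ → P1 k σ
  all-stable⇒P1 (vertices , nonempty , τ , τ-vertex , adj) stable =
    vertices , nonempty , τ , τ-vertex , All.zipWith (λ (a , s) → a , inj₁ s) (adj , stable)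

  independent⇒P1 : ∀ {σ} → P3 k σ → IndependentTriple (C k σ) → P1 k σ
  independent⇒P1 (vertices , nonempty , _) (x , y , z , x∈ , y∈ , z∈ , x≢y , x≢z , y≢z , ¬xy , ¬xz , ¬yz) =
    vertices , nonempty , set₃ x y z , ∣set₃∣ x≢y x≢z y≢z ,
    All.map (λ adj → adj , inj₂ (independent-stable ¬xy ¬xz ¬yz))
            (⊆C⇒neighbour vertices (∣set₃∣ x≢y x≢z y≢z) (set₃⊆ x∈ y∈ z∈))

  P1⇒ : ∀ {σ} → P1 k σ → All (Stable k) σ ⊎ IndependentTriple (C k σ)
  P1⇒ {σ} (_ , _ , τ , τ-vertex , adj) with stable? τ
  ... | no unstable = inj₁ (All.map (λ { (_ , inj₁ s) → s ; (_ , inj₂ s) → ⊥-elim (unstable s) }) adj)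
  ... | yes stable with three-members τ τ-vertex
  ...   | x , y , z , x∈ , y∈ , z∈ , x≢y , x≢z , y≢z =
          inj₂ (x , y , z , in-C x∈ , in-C y∈ , in-C z∈ , x≢y , x≢z , y≢z ,
                stable⇒¬adjacent stable x∈ y∈ , stable⇒¬adjacent stable x∈ z∈ ,
                stable⇒¬adjacent stable y∈ z∈)
    where
    in-C : τ ⊆ C k σ
    in-C = neighbour⊆C (All.map proj₁ adj)

  -- Off P₁, C_σ contains a common neighbour but no independent triple, so the
  -- structure theorem applies.
  shape-of-C : ∀ {σ} → P3 k σ → ¬ IndependentTriple (C k σ) → Shape (C k σ)
  shape-of-C (_ , _ , τ , τ-vertex , adj) free with three-members τ τ-vertex
  ... | x , y , z , x∈ , y∈ , z∈ , x≢y , x≢z , y≢z =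
    WithoutIndependentTriple.structure free (neighbour⊆C adj x∈) (neighbour⊆C adj y∈) (neighbour⊆C adj z∈)
                                       x≢y x≢z y≢z

  P3⇒ : ∀ {σ} → P3 k σ → P1 k σ ⊎ (¬ P1 k σ × Shape (C k σ))
  P3⇒ {σ} p3 with independent-triple? (C k σ) | all? stable? σ
  ... | yes triple | _ = inj₁ (independent⇒P1 p3 triple)
  ... | no _ | yes stable = inj₁ (all-stable⇒P1 p3 stable)
  ... | no free | no unstable = inj₂ ((λ p1 → [ unstable , free ]′ (P1⇒ p1)) , shape-of-C p3 free)

-- Translation between the shapes of C_σ and the index families P_{i,j}, Q_{i,j}.
module Indices (k : ℕ) where
  open Cycle k
  open Structure k
  open Uniqueness k
  open Complexes k

  set₃-by-labels : ∀ a b → set₃ (el k (label a)) (el k (suc (label a))) (el k (label b))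
                         ≡ set₃ a (next a) b
  set₃-by-labels a b rewrite el-label a | el-label-next a | el-label b = refl

  set₄-by-labels : ∀ a b → set₄ (el k (label a)) (el k (suc (label a)))
                                (el k (label b)) (el k (suc (label b)))
                         ≡ set₄ a (next a) b (next b)
  set₄-by-labels a b rewrite el-label a | el-label-next a | el-label b | el-label-next b = refl

  three⇒¬P2 : ∀ {σ} → ¬ P1 k σ → ∣ C k σ ∣ ≡ 3 → ¬ P2 k σ
  three⇒¬P2 ¬p1 _ (inj₁ p1) = ¬p1 p1
  three⇒¬P2 _ three (inj₂ (_ , _ , four)) with trans (sym three) four
  ... | ()

  -- Off P₁, C_σ = {a, a⁺, b} puts σ in P_{i,j} with (i, j) = (label a, label b).
  pair+point⇒P : ∀ {σ a b} → P3 k σ → ¬ P1 k σ → Apart a b → C k σ ≡ set₃ a (next a) b →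
                 InPUnion k σ
  pair+point⇒P {σ} {a} {b} p3 ¬p1 (b≢a⁻ , b≢a , b≢a⁺) C≡ =
    label a , label b , label-range a ,
    (label-range b , renamed (label a ∸ 1) b≢a⁻ (el-label-prev a) ,
     renamed (label a) b≢a (el-label a) , renamed (suc (label a)) b≢a⁺ (el-label-next a)) ,
    p3 , three⇒¬P2 ¬p1 ∣C∣≡3 , trans C≡ (sym (set₃-by-labels a b))
    where
    renamed : ∀ {x} t → b ≢ x → el k t ≡ x → el k (label b) ≢ el k t
    renamed _ b≢x t≡x e = b≢x (trans (sym (el-label b)) (trans e t≡x))
    ∣C∣≡3 : ∣ C k σ ∣ ≡ 3
    ∣C∣≡3 = trans (cong ∣_∣ C≡) (∣set₃∣ (≢-sym (x⁺≢x a)) (≢-sym b≢a) (≢-sym b≢a⁺))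

  ordered⇒InJ : ∀ a b → Apart a b → suc (toℕ a) < toℕ b → InJ k (label a) (label b)
  ordered⇒InJ zero b (b≢a⁻ , _) a⁺<b = inj₁ (refl , s≤s a⁺<b , ≤∧≢⇒< (≤-pred (toℕ<n b)) b-not-last)
    where
    b-not-last : toℕ b ≢ 5 + k
    b-not-last e = b≢a⁻ (begin
      b                    ≡⟨ el-label b ⟨
      el k (suc (toℕ b))   ≡⟨ cong (λ t → el k (suc t)) e ⟩
      el k n               ≡⟨ el-wrap ⟩
      el k 0               ≡⟨ el-label-prev zero ⟩
      prev zero            ∎)
      where open ≡-Reasoning
  ordered⇒InJ (suc a) b _ a⁺<b =
    inj₂ (s≤s (s≤s z≤n) , s≤s (≤-pred (≤-trans a⁺<b (≤-pred (toℕ<n b)))) , s≤s a⁺<b , toℕ<n b)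

  -- Off P₁, C_σ = {a, a⁺, b, b⁺} with a before b puts σ in Q_{label a, label b};
  -- in general the two pairs are first ordered by position.
  ordered-two-pairs⇒Q : ∀ {σ a b} → P3 k σ → ¬ P1 k σ → Apart a b →
                        C k σ ≡ set₄ a (next a) b (next b) → toℕ a < toℕ b → InQUnion k σ
  ordered-two-pairs⇒Q {σ} {a} {b} p3 ¬p1 (b≢a⁻ , b≢a , b≢a⁺) C≡ a<b =
    label a , label b , (s≤s z≤n , ≤-pred (≤-trans a⁺<b (≤-pred (toℕ<n b)))) ,
    ordered⇒InJ a b (b≢a⁻ , b≢a , b≢a⁺) a⁺<b ,
    inj₂ (p3 , ¬p1 , ∣C∣≡4) , ¬p1 , trans C≡ (sym (set₄-by-labels a b))
    where
    b-not-a⁺ : toℕ b ≢ suc (toℕ a)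
    b-not-a⁺ e = b≢a⁺ (trans (sym (el-label b))
                              (trans (cong (λ t → el k (suc t)) e) (el-label-next a)))
    a⁺<b : suc (toℕ a) < toℕ b
    a⁺<b = ≤∧≢⇒< a<b (≢-sym b-not-a⁺)
    ∣C∣≡4 : ∣ C k σ ∣ ≡ 4
    ∣C∣≡4 = trans (cong ∣_∣ C≡)
                  (∣set₄∣ (≢-sym (x⁺≢x a)) (≢-sym b≢a) (λ e → b≢a⁻ (next⇒prev e))
                          (≢-sym b≢a⁺) (λ e → b≢a (sym (next-injective e))) (≢-sym (x⁺≢x b)))

  two-pairs⇒Q : ∀ {σ a b} → P3 k σ → ¬ P1 k σ → Apart a b → C k σ ≡ set₄ a (next a) b (next b) →
                InQUnion k σ
  two-pairs⇒Q {a = a} {b} p3 ¬p1 ab C≡ with <-cmp (toℕ a) (toℕ b)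
  ... | tri< a<b _ _ = ordered-two-pairs⇒Q p3 ¬p1 ab C≡ a<b
  ... | tri≈ _ a≡b _ = ⊥-elim (proj₁ (proj₂ ab) (sym (toℕ-injective a≡b)))
  ... | tri> _ _ b<a = ordered-two-pairs⇒Q p3 ¬p1 (apart-sym ab) (trans C≡ (set₄-swap _ _ _ _)) b<a

  InI⇒apart : ∀ {i j} → InRange n i → InI k i j → Apart (el k i) (el k j)
  InI⇒apart i∈[n] (_ , j≢i-1 , j≢i , j≢i+1) =
    (λ e → j≢i-1 (trans e (sym (el-prev i∈[n])))) , j≢i ,
    (λ e → j≢i+1 (trans e (sym (el-next i∈[n]))))

  P-shape : ∀ {σ i j} → InRange n i → Pij k i j σ → C k σ ≡ set₃ (el k i) (next (el k i)) (el k j)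
  P-shape {i = i} {j} i∈[n] (_ , _ , C≡) =
    trans C≡ (cong (λ u → set₃ (el k i) u (el k j)) (el-next i∈[n]))

  -- Two P-indices of σ name the same shape, hence coincide.

  P-indices-unique : ∀ {σ} (i j i′ j′ : ℕ) → InRange n i → InI k i j →
                     InRange n i′ → InI k i′ j′ →
                     Pij k i j σ → Pij k i′ j′ σ → i ≡ i′ × j ≡ j′
  P-indices-unique {σ} i j i′ j′ i∈ ij i′∈ i′j′ pij pi′j′
    with pair+point-unique (InI⇒apart i∈ ij) (InI⇒apart i′∈ i′j′)
                           (set₃-≡⇒ (trans (sym (P-shape {σ} {i} {j} i∈ pij))
                                           (P-shape {σ} {i′} {j′} i′∈ pi′j′)))
  ... | i≡i′ , j≡j′ = el-injective i∈ i′∈ i≡i′ , el-injective (proj₁ ij) (proj₁ i′j′) j≡j′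

  QIndex : ℕ → ℕ → Set
  QIndex i j = InRange n i × InRange n j × suc i < j × el k j ≢ prev (el k i)

  InJ⇒QIndex : ∀ {i j} → InRange (4 + k) i → InJ k i j → QIndex i j
  InJ⇒QIndex {j = j} _ (inj₁ (refl , 3≤j , j≤5+k)) = 1∈[n] , j∈[n] , 3≤j , j≢0
    where
    1∈[n] : InRange n 1
    1∈[n] = s≤s z≤n , s≤s z≤n
    j∈[n] : InRange n j
    j∈[n] = ≤-trans (s≤s z≤n) 3≤j , ≤-trans j≤5+k (n≤1+n _)
    j≢0 : el k j ≢ prev (el k 1)
    j≢0 e = <-irrefl (el-injective j∈[n] (s≤s z≤n , ≤-refl)
                                   (trans e (trans (sym (el-prev 1∈[n])) (sym el-wrap))))
                     (s≤s j≤5+k)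
  InJ⇒QIndex {suc (suc i₀)} {j} i∈ (inj₂ (s≤s (s≤s z≤n) , _ , i+2≤j , j≤n)) =
    i∈[n] , j∈[n] , i+2≤j , j≢i-1
    where
    i∈[n] : InRange n (suc (suc i₀))
    i∈[n] = s≤s z≤n , ≤-trans (proj₂ i∈) (≤-trans (n≤1+n _) (n≤1+n _))
    i-1∈[n] : InRange n (suc i₀)
    i-1∈[n] = s≤s z≤n , ≤-trans (n≤1+n _) (proj₂ i∈[n])
    j∈[n] : InRange n j
    j∈[n] = ≤-trans (s≤s z≤n) i+2≤j , j≤n
    j≢i-1 : el k j ≢ prev (el k (suc (suc i₀)))
    j≢i-1 e with el-injective j∈[n] i-1∈[n] (trans e (sym (el-prev i∈[n])))
    ... | refl = <-irrefl refl (≤-trans (n≤1+n _) (≤-trans (n≤1+n _) i+2≤j))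

  QIndex⇒apart : ∀ {i j} → QIndex i j → Apart (el k i) (el k j)
  QIndex⇒apart {i} {j} (i∈[n] , j∈[n] , i+1<j , j≢i-1) =
    j≢i-1 ,
    (λ e → <-irrefl (sym (el-injective j∈[n] i∈[n] e)) (<⇒≤ i+1<j)) ,
    (λ e → <-irrefl (sym (el-injective j∈[n] (s≤s z≤n , ≤-trans (<⇒≤ i+1<j) (proj₂ j∈[n]))
                                        (trans e (sym (el-next i∈[n]))))) i+1<j)

  Q-shape : ∀ {σ i j} → QIndex i j → Qij k i j σ →
            C k σ ≡ set₄ (el k i) (next (el k i)) (el k j) (next (el k j))
  Q-shape {i = i} {j} (i∈[n] , j∈[n] , _) (_ , _ , C≡) =
    trans C≡ (cong₂ (λ u v → set₄ (el k i) u (el k j) v) (el-next i∈[n]) (el-next j∈[n]))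

  -- Two Q-indices of σ name the same pairs; in swapped order they would give i < j < i.
  Q-indices-unique : ∀ {σ} (i j i′ j′ : ℕ) → InRange (4 + k) i → InJ k i j →
                     InRange (4 + k) i′ → InJ k i′ j′ →
                     Qij k i j σ → Qij k i′ j′ σ → i ≡ i′ × j ≡ j′
  Q-indices-unique {σ} i j i′ j′ i∈ ij i′∈ i′j′ qij qi′j′
    with InJ⇒QIndex i∈ ij | InJ⇒QIndex i′∈ i′j′
  ... | ij@(i∈[n] , j∈[n] , i<j , _) | i′j′@(i′∈[n] , j′∈[n] , i′<j′ , _)
    with two-pairs-unique (QIndex⇒apart ij) (QIndex⇒apart i′j′)
                          (set₄-≡⇒ (trans (sym (Q-shape {σ} {i} {j} ij qij))
                                          (Q-shape {σ} {i′} {j′} i′j′ qi′j′)))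
  ... | inj₁ (i≡i′ , j≡j′) = el-injective i∈[n] i′∈[n] i≡i′ , el-injective j∈[n] j′∈[n] j≡j′
  ... | inj₂ (i≡j′ , j≡i′) with el-injective i∈[n] j′∈[n] i≡j′ | el-injective j∈[n] i′∈[n] j≡i′
  ...   | refl | refl = ⊥-elim (<-asym (<⇒≤ i<j) (<⇒≤ i′<j′))

  P3⇒parts : ∀ {σ} → P3 k σ → P1 k σ ⊎ InPUnion k σ ⊎ InQUnion k σ
  P3⇒parts p3 with P3⇒ p3
  ... | inj₁ p1 = inj₁ p1
  ... | inj₂ (¬p1 , pair+point _ _ apart C≡) = inj₂ (inj₁ (pair+point⇒P p3 ¬p1 apart C≡))
  ... | inj₂ (¬p1 , two-pairs _ _ apart C≡) = inj₂ (inj₂ (two-pairs⇒Q p3 ¬p1 apart C≡))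

  parts⇒P3 : ∀ {σ} → P1 k σ ⊎ InPUnion k σ ⊎ InQUnion k σ → P3 k σ
  parts⇒P3 (inj₁ p1) = P1⇒P3 p1
  parts⇒P3 (inj₂ (inj₁ (_ , _ , _ , _ , p3 , _))) = p3
  parts⇒P3 (inj₂ (inj₂ (_ , _ , _ , _ , inj₁ p1 , _))) = P1⇒P3 p1
  parts⇒P3 (inj₂ (inj₂ (_ , _ , _ , _ , inj₂ (p3 , _) , _))) = p3

proposition4p1 : (k : ℕ) → (σ : List (Subset (N k))) →
    (P3 k σ ⇔ (P1 k σ ⊎ InPUnion k σ ⊎ InQUnion k σ))
    × ¬ (P1 k σ × InPUnion k σ)
    × ¬ (P1 k σ × InQUnion k σ)
    × ¬ (InPUnion k σ × InQUnion k σ)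
    × ((i j i′ j′ : ℕ) → InRange (N k) i → InI k i j → InRange (N k) i′ → InI k i′ j′ →
         Pij k i j σ → Pij k i′ j′ σ → (i ≡ i′ × j ≡ j′))
    × ((i j i′ j′ : ℕ) → InRange (4 + k) i → InJ k i j → InRange (4 + k) i′ → InJ k i′ j′ →
         Qij k i j σ → Qij k i′ j′ σ → (i ≡ i′ × j ≡ j′))
proposition4p1 k σ =
  mk⇔ P3⇒parts parts⇒P3 ,
  -- P_{i,j} avoids P₂ ⊇ P₁, and Q_{i,j} ⊆ P₂ \ P₁.
  (λ (p1 , _ , _ , _ , _ , _ , ¬p2 , _) → ¬p2 (inj₁ p1)) ,
  (λ (p1 , _ , _ , _ , _ , _ , ¬p1 , _) → ¬p1 p1) ,
  (λ ((_ , _ , _ , _ , _ , ¬p2 , _) , (_ , _ , _ , _ , p2 , _)) → ¬p2 p2) ,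
  P-indices-unique ,
  Q-indices-unique
  where open Indices k
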